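{- Let $M$ be a bounded preordered set and let $\vdash$ be a relation between nonempty finite sequences $a_1,\dots,a_m$ and $b_1,\dots,b_n$ of elements of $M$ satisfying: 1. $a\vdash b\iff a\le b$; 2. $a_1,\dots,a_m\vdash b_1,\dots,b_n$ implies $a_1,\dots,a_m,c\vdash b_1,\dots,b_n$ and $a_1,\dots,a_m\vdash c,b_1,\dots,b_n$; 3. $a_1,\dots,a_m\vdash b_1,\dots,b_n$ implies $a_1,\dots,a_{i+1},a_i,\dots,a_m\vdash b_1,\dots,b_n$ and $a_1,\dots,a_m\vdash b_1,\dots,b_{i+1},b_i,\dots,b_n$; 4. $a_1,\dots,a_m,c\vdash b_1,\dots,b_n$ and $a_1,\dots,a_m\vdash c,b_1,\dots,b_n$ imply $a_1,\dots,a_m\vdash b_1,\dots,b_n$. Then there is a countably complete boolean lattice $V$ over $M$ such that for all $a_1,\dots,a_m,b_1,\dots,b_n\in M$, \[ a_1,\dots,a_m\vdash b_1,\dots,b_n\iff a_1\wedge\dots\wedge a_m\le b_1\vee\dots\vee b_n \text{ in } V, \] and such that for every minimal countably complete boolean lattice $V'$ over $M$ satisfying the same equivalence there is a homomorphism (in the sense below) $\sim$ from $V$ onto $V'$ with $a\sim a$ for all $a\in M$.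
   Context: Preordered set: reflexive transitive $\le$; $a\equiv b$ iff both $a\le b$, $b\le a$; bounded if it has $0,1$ with $0\le a\le1$ for all $a$. A lattice: any $a,b$ have greatest lower bound $a\wedge b$ and least upper bound $a\vee b$ (unique up to $\equiv$); distributive if $a\wedge c\le b$, $a\le b\vee c$ imply $a\le b$. A boolean lattice is a (bounded) distributive lattice in which each $c$ has an element $\neg c$ with $c\wedge\neg c\le 0$ and $c\vee\neg c\ge 1$. A lattice is countably complete if every countable subset $N$ has a greatest lower bound $\forall N$ and a least upper bound $\exists N$. $M$ is a part of $V$ if $M\subseteq V$ and its preorder is the restriction; $V$ is then over $M$. A countably complete boolean lattice $V$ over $M$ is minimal if no proper subset $V_0\subsetneq V$ satisfies: $M\subseteq V_0$; $V_0$ contains every $c\equiv a\wedge b$, $c\equiv a\vee b$, $c\equiv\neg a$ for $a,b\in V_0$; and $V_0$ contains every $c\equiv\forall N$ and $c\equiv\exists N$ for countable $N\subseteq V_0$. A homomorphism from $A$ into $A'$ is a relation $\sim\subseteq A\times A'$ with: every $a$ has some $a'\sim$-related; $a\sim a_1'$, $a_1'\equiv a_2'$ imply $a\sim a_2'$; $a\sim a'$, $b\sim b'$, $a\le b$ imply $a'\le b'$; onto if every $a'$ has a preimage. Here "homomorphism" between countably complete boolean lattices additionally requires: $a\sim a'$, $b\sim b'$ imply $a\wedge b\sim a'\wedge b'$ and $a\vee b\sim a'\vee b'$ (for all representatives up to $\equiv$); $a\sim a'$ implies $\neg a\sim\neg a'$; and if for a countable $N\subseteq V$ the relation $\sim$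 restricts to a homomorphism from $N$ onto $N'$, then $\forall N\sim\forall N'$ and $\exists N\sim\exists N'$. -}

module Defs where

open import Data.Nat using (ℕ)
open import Data.Maybe using (Maybe; just)
open import Data.Product using (Σ; _×_; _,_)
open import Data.List using (List; _++_; _∷_)
open import Data.List.NonEmpty using (List⁺; toList; foldr₁; _∷⁺_; _⁺∷ʳ_)
import Data.List.NonEmpty as L⁺
open import Relation.Binary.PropositionalEquality using (_≡_)
open import Function using (_⇔_)
import Data.Sum

-- the equivalence a ≡ b of the paper (written _≋_ here, since _≡_ is
-- Agda's propositional equality)
Equiv : {C : Set} → (C → C → Set) → C → C → Set
Equiv _≤_ a b = (a ≤ b) × (b ≤ a)

IsGLB : {C : Set} → (C → C → Set) → (C → Set) → C → Set
IsGLB {C} _≤_ P g = (∀ x → P x → g ≤ x) × (∀ (h : C) → (∀ x → P x → h ≤ x) → h ≤ g)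

IsLUB : {C : Set} → (C → C → Set) → (C → Set) → C → Set
IsLUB {C} _≤_ P g = (∀ x → P x → x ≤ g) × (∀ (h : C) → (∀ x → P x → x ≤ h) → g ≤ h)

-- Countable subsets: a countable subset of C (possibly empty or finite)
-- is presented as the set of values of an enumeration ℕ → Maybe C.

CSub : Set → Set
CSub C = ℕ → Maybe C

_∈ₑ_ : {C : Set} → C → CSub C → Set
x ∈ₑ e = Σ ℕ (λ n → e n ≡ just x)

record BoundedPreorder : Set₁ where
  field
    Carrier : Set
    _≤_     : Carrier → Carrier → Set
    ≤-refl  : ∀ a → a ≤ a
    ≤-trans : ∀ {a b c} → a ≤ b → b ≤ c → a ≤ c
    𝟘 𝟙     : Carrier
    𝟘-least : ∀ a → 𝟘 ≤ a
    𝟙-great : ∀ a → a ≤ 𝟙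

record CCBL : Set₁ where
  field
    Carrier : Set
    _≤_     : Carrier → Carrier → Set
    ≤-refl  : ∀ a → a ≤ a
    ≤-trans : ∀ {a b c} → a ≤ b → b ≤ c → a ≤ c
    𝟘 𝟙     : Carrier
    𝟘-least : ∀ a → 𝟘 ≤ a
    𝟙-great : ∀ a → a ≤ 𝟙
    _∧_ _∨_ : Carrier → Carrier → Carrier
    ∧-glb   : ∀ a b → IsGLB _≤_ (λ x → (x ≡ a) Data.Sum.⊎ (x ≡ b)) (a ∧ b)
    ∨-lub   : ∀ a b → IsLUB _≤_ (λ x → (x ≡ a) Data.Sum.⊎ (x ≡ b)) (a ∨ b)
    distrib : ∀ a b c → (a ∧ c) ≤ b → a ≤ (b ∨ c) → a ≤ b
    ¬_      : Carrier → Carrier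
    compl-∧ : ∀ c → (c ∧ (¬ c)) ≤ 𝟘
    compl-∨ : ∀ c → 𝟙 ≤ (c ∨ (¬ c))
    ⋀ ⋁     : CSub Carrier → Carrier
    ⋀-glb   : ∀ e → IsGLB _≤_ (λ x → x ∈ₑ e) (⋀ e)
    ⋁-lub   : ∀ e → IsLUB _≤_ (λ x → x ∈ₑ e) (⋁ e)

  _≋_ : Carrier → Carrier → Set
  _≋_ = Equiv _≤_

-- A countably complete boolean lattice over M: M is a part of it,
-- i.e. an injective inclusion ι whose image carries exactly M's preorder.

record CCBLOver (M : BoundedPreorder) : Set₁ where
  field
    lat   : CCBL
  open CCBL lat public
  module M = BoundedPreorder M
  field
    ι       : M.Carrier → Carrier
    ι-inj   : ∀ a b → ι a ≡ ι b → a ≡ b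
    ι-order : ∀ a b → (a M.≤ b) ⇔ (ι a ≤ ι b)

  record Closed (V₀ : Carrier → Set) : Set where
    field
      has-M : ∀ a → V₀ (ι a)
      cl-∧  : ∀ a b c → V₀ a → V₀ b → c ≋ (a ∧ b) → V₀ c
      cl-∨  : ∀ a b c → V₀ a → V₀ b → c ≋ (a ∨ b) → V₀ c
      cl-¬  : ∀ a c → V₀ a → c ≋ (¬ a) → V₀ c
      cl-⋀  : ∀ (N : CSub Carrier) → (∀ x → x ∈ₑ N → V₀ x) → ∀ c → c ≋ ⋀ N → V₀ c
      cl-⋁  : ∀ (N : CSub Carrier) → (∀ x → x ∈ₑ N → V₀ x) → ∀ c → c ≋ ⋁ N → V₀ c

  Minimal : Set₁
  Minimal = ∀ (V₀ : Carrier → Set) → Closed V₀ → ∀ x → V₀ x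

module _ (V V' : CCBL) where
  private
    module V  = CCBL V
    module V' = CCBL V'

  -- ∼ restricted to N × N' is a homomorphism (of preordered parts)
  -- from N onto N'
  RestrictsOnto : (V.Carrier → V'.Carrier → Set) →
                  (V.Carrier → Set) → (V'.Carrier → Set) → Set
  RestrictsOnto _∼_ N N' =
    (∀ a → N a → Σ V'.Carrier (λ a' → N' a' × (a ∼ a'))) ×
    (∀ a a₁' a₂' → N a → N' a₁' → N' a₂' → a ∼ a₁' → a₁' V'.≋ a₂' → a ∼ a₂') ×
    (∀ a b a' b' → N a → N b → N' a' → N' b' → a ∼ a' → b ∼ b' →
        a V.≤ b → a' V'.≤ b') ×
    (∀ a' → N' a' → Σ V.Carrier (λ a → N a × (a ∼ a')))

  record Hom : Set₁ where
    field
      _∼_   : V.Carrier → V'.Carrier → Set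
      total : ∀ a → Σ V'.Carrier (λ a' → a ∼ a')
      resp  : ∀ a a₁' a₂' → a ∼ a₁' → a₁' V'.≋ a₂' → a ∼ a₂'
      mono  : ∀ a b a' b' → a ∼ a' → b ∼ b' → a V.≤ b → a' V'.≤ b'
      hom-∧ : ∀ a b a' b' → a ∼ a' → b ∼ b' →
              ∀ c c' → c V.≋ (a V.∧ b) → c' V'.≋ (a' V'.∧ b') → c ∼ c'
      hom-∨ : ∀ a b a' b' → a ∼ a' → b ∼ b' →
              ∀ c c' → c V.≋ (a V.∨ b) → c' V'.≋ (a' V'.∨ b') → c ∼ c'
      hom-¬ : ∀ a a' → a ∼ a' →
              ∀ c c' → c V.≋ (V.¬ a) → c' V'.≋ (V'.¬ a') → c ∼ c'
      hom-⋀ : ∀ (N : CSub V.Carrier) (N' : V'.Carrier → Set) →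
              RestrictsOnto _∼_ (λ x → x ∈ₑ N) N' →
              ∀ g g' → IsGLB V._≤_ (λ x → x ∈ₑ N) g → IsGLB V'._≤_ N' g' → g ∼ g'
      hom-⋁ : ∀ (N : CSub V.Carrier) (N' : V'.Carrier → Set) →
              RestrictsOnto _∼_ (λ x → x ∈ₑ N) N' →
              ∀ g g' → IsLUB V._≤_ (λ x → x ∈ₑ N) g → IsLUB V'._≤_ N' g' → g ∼ g'

    Onto : Set
    Onto = ∀ a' → Σ V.Carrier (λ a → a ∼ a')

module _ (M : BoundedPreorder) where
  open BoundedPreorder M

  AdjSwap : List⁺ Carrier → List⁺ Carrier → Set
  AdjSwap l l' = Σ (List Carrier) λ xs → Σ Carrier λ u → Σ Carrier λ v →
    Σ (List Carrier) λ ys →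
      (toList l ≡ xs ++ (u ∷ v ∷ ys)) × (toList l' ≡ xs ++ (v ∷ u ∷ ys))

  record SequentAxioms (_⊢_ : List⁺ Carrier → List⁺ Carrier → Set) : Set where
    field
      ax1  : ∀ a b → (L⁺.[ a ] ⊢ L⁺.[ b ]) ⇔ (a ≤ b)
      ax2ˡ : ∀ as bs c → as ⊢ bs → (as ⁺∷ʳ c) ⊢ bs
      ax2ʳ : ∀ as bs c → as ⊢ bs → as ⊢ (c ∷⁺ bs)
      ax3ˡ : ∀ as as' bs → AdjSwap as as' → as ⊢ bs → as' ⊢ bs
      ax3ʳ : ∀ as bs bs' → AdjSwap bs bs' → as ⊢ bs → as ⊢ bs'
      ax4  : ∀ as bs c → (as ⁺∷ʳ c) ⊢ bs → as ⊢ (c ∷⁺ bs) → as ⊢ bs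

  Represents : CCBLOver M → (List⁺ Carrier → List⁺ Carrier → Set) → Set
  Represents V _⊢_ = ∀ as bs →
    (as ⊢ bs) ⇔ (foldr₁ V._∧_ (L⁺.map V.ι as) V.≤ foldr₁ V._∨_ (L⁺.map V.ι bs))
    where module V = CCBLOver V

module Submission where

-- The sequent relation ⊢ on M is represented in the free countably
-- complete boolean lattice V on the generators M subject to the relations
-- a₁ ∧ … ∧ aₘ ≤ b₁ ∨ … ∨ bₙ for a₁,…,aₘ ⊢ b₁,…,bₙ; V is presented
-- syntactically by formulas and an inductively generated preorder.
--   * Representation has two halves.  "⊢ implies ≤" holds by construction.
--     "≤ implies ⊢" (conservativity) is shown by a forcing semantics on
--     worlds (G , D) of sequents, with a relative double negation J,
--     using the derived sequent rules (exchange, weakening, cut, identity,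
--     contraction) obtained from the axioms 1–4.
--   * Universality: evaluating formulas in any V' over M representing ⊢
--     preserves order and all operations.  For any such structure-preserving
--     map, its graph (up to ≋) is a homomorphism, and its image is closed
--     under the operations, hence everything when V' is minimal.

open import Defs
open import Data.Maybe using (Maybe; just; nothing)
open import Data.Product using (Σ; _×_; _,_; proj₁; proj₂)
open import Data.Sum using (_⊎_; inj₁; inj₂)
open import Data.Nat using (ℕ)
open import Data.Unit using (⊤; tt)
open import Data.Empty using (⊥)
open import Data.List using (List; []; _∷_; _++_; [_]; _∷ʳ_)
open import Data.List.Properties using (++-assoc; ++-identityʳ)
open import Data.List.NonEmpty using (List⁺; toList; _∷⁺_) renaming (_∷_ to _∷₁_)
import Data.List.NonEmpty as List⁺
open import Data.List.Membership.Propositional using (_∈_)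
open import Data.List.Membership.Propositional.Properties using (∈-∃++; ∈-++⁺ʳ)
open import Data.List.Relation.Unary.Any using (here; there)
open import Data.List.Relation.Binary.Permutation.Propositional
  using (_↭_; refl; prep; swap; trans; ↭-sym; ↭-trans)
open import Data.List.Relation.Binary.Permutation.Propositional.Properties
  using (shift; ∷↭∷ʳ; ++-comm)
open import Function using (flip; Equivalence; mk⇔)
open import Relation.Binary.PropositionalEquality using (_≡_; refl; sym; cong; subst; subst₂)

module Bounds {C : Set} (_≤_ : C → C → Set)
  (≤-trans : ∀ {a b c} → a ≤ b → b ≤ c → a ≤ c) where

  _⋈_ : (C → Set) → (C → Set) → Set
  P ⋈ Q = (∀ x → P x → Σ C λ y → Q y × Equiv _≤_ x y)
        × (∀ y → Q y → Σ C λ x → P x × Equiv _≤_ x y)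

  glb-resp : ∀ {P Q g} → P ⋈ Q → IsGLB _≤_ P g → IsGLB _≤_ Q g
  glb-resp (P→Q , Q→P) (lower , greatest) =
    (λ y Qy → let (x , Px , x≋y) = Q→P y Qy in ≤-trans (lower x Px) (proj₁ x≋y)) ,
    (λ h h≤Q → greatest h λ x Px →
      let (y , Qy , x≋y) = P→Q x Px in ≤-trans (h≤Q y Qy) (proj₂ x≋y))

  glb-unique : ∀ {P g g'} → IsGLB _≤_ P g → IsGLB _≤_ P g' → Equiv _≤_ g g'
  glb-unique {g = g} {g'} (lower , greatest) (lower' , greatest') =
    greatest' g lower , greatest g' lower'

module LatticeFacts (L : CCBL) where
  open CCBL L

  ≋-refl : ∀ {a} → a ≋ a
  ≋-refl {a} = ≤-refl a , ≤-refl a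

  ≋-sym : ∀ {a b} → a ≋ b → b ≋ a
  ≋-sym (p , q) = q , p

  ≋-trans : ∀ {a b c} → a ≋ b → b ≋ c → a ≋ c
  ≋-trans (p , q) (p' , q') = ≤-trans p p' , ≤-trans q' q

  ∧-lower₁ : ∀ a b → (a ∧ b) ≤ a
  ∧-lower₁ a b = proj₁ (∧-glb a b) a (inj₁ refl)

  ∧-lower₂ : ∀ a b → (a ∧ b) ≤ b
  ∧-lower₂ a b = proj₁ (∧-glb a b) b (inj₂ refl)

  ∧-greatest : ∀ {h a b} → h ≤ a → h ≤ b → h ≤ (a ∧ b)
  ∧-greatest {h} {a} {b} p q =
    proj₂ (∧-glb a b) h λ { x (inj₁ refl) → p ; x (inj₂ refl) → q }

  ∨-upper₁ : ∀ a b → a ≤ (a ∨ b)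
  ∨-upper₁ a b = proj₁ (∨-lub a b) a (inj₁ refl)

  ∨-upper₂ : ∀ a b → b ≤ (a ∨ b)
  ∨-upper₂ a b = proj₁ (∨-lub a b) b (inj₂ refl)

  ∨-least : ∀ {h a b} → a ≤ h → b ≤ h → (a ∨ b) ≤ h
  ∨-least {h} {a} {b} p q =
    proj₂ (∨-lub a b) h λ { x (inj₁ refl) → p ; x (inj₂ refl) → q }

  ∧-mono : ∀ {a a' b b'} → a ≤ a' → b ≤ b' → (a ∧ b) ≤ (a' ∧ b')
  ∧-mono {a} {b = b} p q = ∧-greatest (≤-trans (∧-lower₁ a b) p) (≤-trans (∧-lower₂ a b) q)

  ∨-mono : ∀ {a a' b b'} → a ≤ a' → b ≤ b' → (a ∨ b) ≤ (a' ∨ b')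
  ∨-mono {a' = a'} {b' = b'} p q = ∨-least (≤-trans p (∨-upper₁ a' b')) (≤-trans q (∨-upper₂ a' b'))

  -- complementation reverses the order: ¬b ∧ a ≤ 0 and ¬b ≤ ¬a ∨ a,
  -- so distributivity yields ¬b ≤ ¬a
  ¬-antitone : ∀ {a b} → a ≤ b → (¬ b) ≤ (¬ a)
  ¬-antitone {a} {b} a≤b = distrib (¬ b) (¬ a) a
    (≤-trans (∧-greatest (≤-trans (∧-lower₂ (¬ b) a) a≤b) (∧-lower₁ (¬ b) a))
             (≤-trans (compl-∧ b) (𝟘-least _)))
    (≤-trans (𝟙-great _) (≤-trans (compl-∨ a) (∨-least (∨-upper₂ (¬ a) a) (∨-upper₁ (¬ a) a))))

  ∧-cong : ∀ {a a' b b'} → a ≋ a' → b ≋ b' → (a ∧ b) ≋ (a' ∧ b')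
  ∧-cong (p , p') (q , q') = ∧-mono p q , ∧-mono p' q'

  ∨-cong : ∀ {a a' b b'} → a ≋ a' → b ≋ b' → (a ∨ b) ≋ (a' ∨ b')
  ∨-cong (p , p') (q , q') = ∨-mono p q , ∨-mono p' q'

  ¬-cong : ∀ {a a'} → a ≋ a' → (¬ a) ≋ (¬ a')
  ¬-cong (p , p') = ¬-antitone p' , ¬-antitone p

  open Bounds _≤_ ≤-trans public

  -- least upper bounds are greatest lower bounds for the reversed order
  private
    module Dual = Bounds (flip _≤_) (λ p q → ≤-trans q p)

    ⋈-dual : ∀ {P Q} → P ⋈ Q → P Dual.⋈ Q
    ⋈-dual (P→Q , Q→P) =
      (λ x Px → let (y , Qy , x≋y) = P→Q x Px in y , Qy , ≋-sym x≋y) ,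
      (λ y Qy → let (x , Px , x≋y) = Q→P y Qy in x , Px , ≋-sym x≋y)

  lub-resp : ∀ {P Q g} → P ⋈ Q → IsLUB _≤_ P g → IsLUB _≤_ Q g
  lub-resp m = Dual.glb-resp (⋈-dual m)

  lub-unique : ∀ {P g g'} → IsLUB _≤_ P g → IsLUB _≤_ P g' → g ≋ g'
  lub-unique g g' = ≋-sym (Dual.glb-unique g g')

Image : {A B : Set} → (A → B) → CSub A → B → Set
Image {A} f e y = Σ A λ x → x ∈ₑ e × f x ≡ y

module _ (V V' : CCBL) where
  private
    module V  = CCBL V
    module V' = CCBL V'

  record Preserving : Set where
    field
      map    : V.Carrier → V'.Carrier
      mono   : ∀ {a b} → a V.≤ b → map a V'.≤ map b
      pres-∧ : ∀ a b → map (a V.∧ b) V'.≋ (map a V'.∧ map b)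
      pres-∨ : ∀ a b → map (a V.∨ b) V'.≋ (map a V'.∨ map b)
      pres-¬ : ∀ a → map (V.¬ a) V'.≋ (V'.¬ map a)
      pres-⋀ : ∀ e → IsGLB V'._≤_ (Image map e) (map (V.⋀ e))
      pres-⋁ : ∀ e → IsLUB V'._≤_ (Image map e) (map (V.⋁ e))

module GraphHom {V V' : CCBL} (f : Preserving V V') where
  private
    module V  = CCBL V
    module V' = CCBL V'
    module F  = LatticeFacts V
    module F' = LatticeFacts V'
  open Preserving f

  _∼_ : V.Carrier → V'.Carrier → Set
  a ∼ a' = map a V'.≋ a'

  map-cong : ∀ {a b} → a V.≋ b → map a V'.≋ map b
  map-cong (p , q) = mono p , mono q

  restriction-matches : ∀ N N' → RestrictsOnto V V' _∼_ (λ x → x ∈ₑ N) N' →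
                        F'._⋈_ (Image map N) N'
  restriction-matches N N' (total , _ , _ , onto) =
    (λ { y (x , x∈N , refl) → let (x' , x'∈N' , x∼x') = total x x∈N in x' , x'∈N' , x∼x' }) ,
    (λ x' x'∈N' → let (x , x∈N , x∼x') = onto x' x'∈N' in map x , (x , x∈N , refl) , x∼x')

  hom : Hom V V'
  hom = record
    { _∼_   = _∼_
    ; total = λ a → map a , F'.≋-refl
    ; resp  = λ _ _ _ a∼a₁ a₁≋a₂ → F'.≋-trans a∼a₁ a₁≋a₂
    ; mono  = λ _ _ _ _ a∼a' b∼b' a≤b →
        V'.≤-trans (proj₂ a∼a') (V'.≤-trans (mono a≤b) (proj₁ b∼b'))
    ; hom-∧ = λ a b _ _ a∼a' b∼b' _ _ c≋ c'≋ →
        F'.≋-trans (map-cong c≋) (F'.≋-trans (pres-∧ a b)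
          (F'.≋-trans (F'.∧-cong a∼a' b∼b') (F'.≋-sym c'≋)))
    ; hom-∨ = λ a b _ _ a∼a' b∼b' _ _ c≋ c'≋ →
        F'.≋-trans (map-cong c≋) (F'.≋-trans (pres-∨ a b)
          (F'.≋-trans (F'.∨-cong a∼a' b∼b') (F'.≋-sym c'≋)))
    ; hom-¬ = λ a _ a∼a' _ _ c≋ c'≋ →
        F'.≋-trans (map-cong c≋) (F'.≋-trans (pres-¬ a)
          (F'.≋-trans (F'.¬-cong a∼a') (F'.≋-sym c'≋)))
    ; hom-⋀ = λ N N' r g g' g-glb g'-glb →
        F'.≋-trans (map-cong (F.glb-unique g-glb (V.⋀-glb N)))
          (F'.glb-unique (F'.glb-resp (restriction-matches N N' r) (pres-⋀ N)) g'-glb)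
    ; hom-⋁ = λ N N' r g g' g-lub g'-lub →
        F'.≋-trans (map-cong (F.lub-unique g-lub (V.⋁-lub N)))
          (F'.lub-unique (F'.lub-resp (restriction-matches N N' r) (pres-⋁ N)) g'-lub)
    }

-- If a preserving map V → V' fixes M, its image (up to equivalence) is
-- closed in the sense of minimality, so it covers a minimal V': the graph
-- homomorphism is onto.
module GraphOnto {M : BoundedPreorder} (V V' : CCBLOver M)
  (minimal : CCBLOver.Minimal V')
  (f : Preserving (CCBLOver.lat V) (CCBLOver.lat V'))
  (fixes-M : ∀ a → CCBLOver._≋_ V' (Preserving.map f (CCBLOver.ι V a)) (CCBLOver.ι V' a))
  where
  private
    module V  = CCBLOver V
    module V' = CCBLOver V'
    module F' = LatticeFacts V'.lat
  open Preserving f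

  Preimage : V'.Carrier → Set
  Preimage y = Σ V.Carrier λ x → map x V'.≋ y

  -- the chosen preimage of an entry of an enumeration (no choice principle
  -- is needed: the preimages are supplied by a function)
  pick : (m : Maybe V'.Carrier) → (∀ y → m ≡ just y → Preimage y) → Maybe V.Carrier
  pick nothing  _      = nothing
  pick (just y) choose = just (proj₁ (choose y refl))

  pick-sound : ∀ m choose x → pick m choose ≡ just x →
               Σ V'.Carrier λ y → m ≡ just y × map x V'.≋ y
  pick-sound (just y) choose _ refl = y , refl , proj₂ (choose y refl)

  pick-complete : ∀ m choose y (m≡y : m ≡ just y) →
                  pick m choose ≡ just (proj₁ (choose y m≡y))
  pick-complete _ choose y refl = refl

  preimage-family : ∀ N → (∀ y → y ∈ₑ N → Preimage y) →
                    Σ (CSub V.Carrier) λ e → F'._⋈_ (Image map e) (λ y → y ∈ₑ N)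
  preimage-family N has = e ,
    (λ { y (x , (n , eₙ≡x) , refl) →
           let (y' , Nₙ≡y' , x≋y') = pick-sound (N n) (choose n) x eₙ≡x
           in y' , (n , Nₙ≡y') , x≋y' }) ,
    (λ { y (n , Nₙ≡y) →
           map (proj₁ (has y (n , Nₙ≡y))) ,
           (_ , (n , pick-complete (N n) (choose n) y Nₙ≡y) , refl) ,
           proj₂ (has y (n , Nₙ≡y)) })
    where
    choose : ∀ n y → N n ≡ just y → Preimage y
    choose n y Nₙ≡y = has y (n , Nₙ≡y)
    e : CSub V.Carrier
    e n = pick (N n) (choose n)

  image-closed : V'.Closed Preimage
  image-closed = record
    { has-M = λ a → V.ι a , fixes-M a
    ; cl-∧  = λ { _ _ _ (x , fx≋) (y , fy≋) c≋ →
        x V.∧ y , F'.≋-trans (pres-∧ x y) (F'.≋-trans (F'.∧-cong fx≋ fy≋) (F'.≋-sym c≋)) }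
    ; cl-∨  = λ { _ _ _ (x , fx≋) (y , fy≋) c≋ →
        x V.∨ y , F'.≋-trans (pres-∨ x y) (F'.≋-trans (F'.∨-cong fx≋ fy≋) (F'.≋-sym c≋)) }
    ; cl-¬  = λ { _ _ (x , fx≋) c≋ →
        V.¬ x , F'.≋-trans (pres-¬ x) (F'.≋-trans (F'.¬-cong fx≋) (F'.≋-sym c≋)) }
    ; cl-⋀  = λ N has c c≋ → let (e , e≈N) = preimage-family N has in
        V.⋀ e , F'.≋-trans (F'.glb-unique (F'.glb-resp e≈N (pres-⋀ e)) (V'.⋀-glb N)) (F'.≋-sym c≋)
    ; cl-⋁  = λ N has c c≋ → let (e , e≈N) = preimage-family N has in
        V.⋁ e , F'.≋-trans (F'.lub-unique (F'.lub-resp e≈N (pres-⋁ e)) (V'.⋁-lub N)) (F'.≋-sym c≋)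
    }

  onto : Hom.Onto (GraphHom.hom f)
  onto = minimal Preimage image-closed

module _ {A : Set} (P : List A → Set)
  (swapped : ∀ xs u v ys → P (xs ++ u ∷ v ∷ ys) → P (xs ++ v ∷ u ∷ ys)) where

  perm-invariant-suffix : ∀ pre {l l'} → l ↭ l' → P (pre ++ l) → P (pre ++ l')
  perm-invariant-suffix pre refl p = p
  perm-invariant-suffix pre (prep x l↭l') p =
    subst P (++-assoc pre [ x ] _)
      (perm-invariant-suffix (pre ++ [ x ]) l↭l' (subst P (sym (++-assoc pre [ x ] _)) p))
  perm-invariant-suffix pre (swap x y l↭l') p =
    subst P (++-assoc pre (y ∷ x ∷ []) _)
      (perm-invariant-suffix (pre ++ y ∷ x ∷ []) l↭l'
        (subst P (sym (++-assoc pre (y ∷ x ∷ []) _)) (swapped pre x y _ p)))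
  perm-invariant-suffix pre (trans l↭m m↭l') p =
    perm-invariant-suffix pre m↭l' (perm-invariant-suffix pre l↭m p)

  perm-invariant : ∀ {l l'} → l ↭ l' → P l → P l'
  perm-invariant = perm-invariant-suffix []

∈⇒↭-front : ∀ {A : Set} {a : A} {G} → a ∈ G → Σ (List A) λ G' → G ↭ a ∷ G'
∈⇒↭-front {a = a} a∈G with ∈-∃++ a∈G
... | ys , zs , refl = ys ++ zs , shift a ys zs

-- To allow empty contexts we pad them with 𝟙 and 𝟘.
module Sequents (M : BoundedPreorder)
  (_⊢_ : List⁺ (BoundedPreorder.Carrier M) → List⁺ (BoundedPreorder.Carrier M) → Set)
  (ax : SequentAxioms M _⊢_) where
  open BoundedPreorder M renaming (Carrier to C)
  open SequentAxioms ax

  -- ⊢ between plain lists: the sequent holds for all nonempty lists with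
  -- these entries (vacuously true when one side is empty)
  infix 4 _⊩_
  _⊩_ : List C → List C → Set
  L ⊩ K = ∀ l k → toList l ≡ L → toList k ≡ K → l ⊢ k

  ⊩-intro : ∀ {l k} → l ⊢ k → toList l ⊩ toList k
  ⊩-intro {x ∷₁ xs} {y ∷₁ ys} l⊢k (.x ∷₁ .xs) (.y ∷₁ .ys) refl refl = l⊢k

  ⊩-elim : ∀ {l k} → toList l ⊩ toList k → l ⊢ k
  ⊩-elim {l} {k} L⊩K = L⊩K l k refl refl

  axiom : ∀ {a b} → a ≤ b → [ a ] ⊩ [ b ]
  axiom {a} {b} a≤b = ⊩-intro (Equivalence.from (ax1 a b) a≤b)

  nonempty : ∀ xs u rest → Σ (List⁺ C) λ l → toList l ≡ xs ++ u ∷ rest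
  nonempty []       u rest = u ∷₁ rest , refl
  nonempty (x ∷ xs) u rest = x ∷₁ (xs ++ u ∷ rest) , refl

  permˡ : ∀ {L L' K} → L ↭ L' → L ⊩ K → L' ⊩ K
  permˡ {K = K} = perm-invariant (_⊩ K) swapˡ
    where
    swapˡ : ∀ xs u v ys → (xs ++ u ∷ v ∷ ys) ⊩ K → (xs ++ v ∷ u ∷ ys) ⊩ K
    swapˡ xs u v ys L⊩K l' k l'≡ k≡ =
      let (l , l≡) = nonempty xs u (v ∷ ys)
      in ax3ˡ l l' k (xs , u , v , ys , l≡ , l'≡) (L⊩K l k l≡ k≡)

  permʳ : ∀ {L K K'} → K ↭ K' → L ⊩ K → L ⊩ K'
  permʳ {L} = perm-invariant (L ⊩_) swapʳ
    where
    swapʳ : ∀ xs u v ys → L ⊩ (xs ++ u ∷ v ∷ ys) → L ⊩ (xs ++ v ∷ u ∷ ys)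
    swapʳ xs u v ys L⊩K l k' l≡ k'≡ =
      let (k , k≡) = nonempty xs u (v ∷ ys)
      in ax3ʳ l k k' (xs , u , v , ys , k≡ , k'≡) (L⊩K l k l≡ k≡)

  weakenˡ : ∀ {x xs K} E → (x ∷ xs) ⊩ K → (x ∷ xs ++ E) ⊩ K
  weakenˡ {x} {xs} {K} [] L⊩K = subst (λ z → (x ∷ z) ⊩ K) (sym (++-identityʳ xs)) L⊩K
  weakenˡ {x} {xs} {K} (e ∷ E) L⊩K =
    subst (λ z → (x ∷ z) ⊩ K) (++-assoc xs [ e ] E) (weakenˡ E weaken₁)
    where
    weaken₁ : (x ∷ xs ∷ʳ e) ⊩ K
    weaken₁ (.x ∷₁ ._) k refl k≡ = ax2ˡ (x ∷₁ xs) k e (L⊩K _ k refl k≡)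

  weakenʳ₁ : ∀ {L y ys} f → L ⊩ (y ∷ ys) → L ⊩ (f ∷ y ∷ ys)
  weakenʳ₁ f L⊩K l (.f ∷₁ ._) l≡ refl = ax2ʳ l _ f (L⊩K l _ l≡ refl)

  weakenʳ : ∀ {L y ys} F → L ⊩ (y ∷ ys) → L ⊩ (F ++ y ∷ ys)
  weakenʳ []           L⊩K = L⊩K
  weakenʳ (f ∷ [])     L⊩K = weakenʳ₁ f L⊩K
  weakenʳ (f ∷ f' ∷ F) L⊩K = weakenʳ₁ f (weakenʳ (f' ∷ F) L⊩K)

  cut : ∀ {L K} c → (L ∷ʳ c) ⊩ K → L ⊩ (c ∷ K) → L ⊩ K
  cut c L,c⊩K L⊩c,K (x ∷₁ xs) k refl k≡ =
    ax4 _ k c (L,c⊩K _ k refl k≡) (L⊩c,K _ (c ∷⁺ k) refl (cong (c ∷_) k≡))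

  -- padding with 𝟙 on the left and 𝟘 on the right is harmless: both can
  -- be cut away using the axioms a ≤ 𝟙 and 𝟘 ≤ b
  drop-𝟙 : ∀ {x xs y ys} → (𝟙 ∷ x ∷ xs) ⊩ (y ∷ ys) → (x ∷ xs) ⊩ (y ∷ ys)
  drop-𝟙 {x} {xs} {y} {ys} 𝟙,L⊩K = cut 𝟙 (permˡ (∷↭∷ʳ 𝟙 (x ∷ xs)) 𝟙,L⊩K) L⊩𝟙,K
    where
    L⊩𝟙,K : (x ∷ xs) ⊩ (𝟙 ∷ y ∷ ys)
    L⊩𝟙,K = permʳ (↭-sym (∷↭∷ʳ 𝟙 (y ∷ ys))) (weakenʳ (y ∷ ys) (weakenˡ xs (axiom (𝟙-great x))))

  drop-𝟘 : ∀ {x xs y ys} → (x ∷ xs) ⊩ (𝟘 ∷ y ∷ ys) → (x ∷ xs) ⊩ (y ∷ ys)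
  drop-𝟘 {x} {xs} {y} {ys} L⊩𝟘,K = cut 𝟘 L,𝟘⊩K L⊩𝟘,K
    where
    L,𝟘⊩K : (x ∷ xs ∷ʳ 𝟘) ⊩ (y ∷ ys)
    L,𝟘⊩K = permˡ (∷↭∷ʳ 𝟘 (x ∷ xs))
      (permʳ (↭-sym (∷↭∷ʳ y ys)) (weakenʳ ys (weakenˡ (x ∷ xs) (axiom (𝟘-least y)))))

  infix 4 _⊢*_
  _⊢*_ : List C → List C → Set
  G ⊢* D = (𝟙 ∷ G) ⊩ (𝟘 ∷ D)

  raise : ∀ {l k} → l ⊢ k → toList l ⊢* toList k
  raise {x ∷₁ xs} l⊢k = permˡ (↭-sym (∷↭∷ʳ 𝟙 (x ∷ xs))) (weakenʳ [ 𝟘 ] (weakenˡ [ 𝟙 ] (⊩-intro l⊢k)))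

  lower : ∀ {l k} → toList l ⊢* toList k → l ⊢ k
  lower {_ ∷₁ _} {_ ∷₁ _} G⊢*D = ⊩-elim (drop-𝟘 (drop-𝟙 G⊢*D))

  permˡ* : ∀ {G G' D} → G ↭ G' → G ⊢* D → G' ⊢* D
  permˡ* G↭G' = permˡ (prep 𝟙 G↭G')

  permʳ* : ∀ {G D D'} → D ↭ D' → G ⊢* D → G ⊢* D'
  permʳ* D↭D' = permʳ (prep 𝟘 D↭D')

  weakenˡ* : ∀ {G D} E → G ⊢* D → (G ++ E) ⊢* D
  weakenˡ* = weakenˡ

  weakenʳ* : ∀ {G D} F → G ⊢* D → G ⊢* (F ++ D)
  weakenʳ* {D = D} F G⊢*D = permʳ (shift 𝟘 F D) (weakenʳ F G⊢*D)

  cut* : ∀ {G D} c → (G ∷ʳ c) ⊢* D → G ⊢* (c ∷ D) → G ⊢* D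
  cut* c G,c⊢*D G⊢*c,D = cut c G,c⊢*D (permʳ (swap 𝟘 c refl) G⊢*c,D)

  identity* : ∀ {a G D} → a ∈ G → a ∈ D → G ⊢* D
  identity* {a} a∈G a∈D with ∈⇒↭-front a∈G | ∈⇒↭-front a∈D
  ... | G' , G↭ | D' , D↭ =
    permˡ (↭-trans (swap a 𝟙 refl) (prep 𝟙 (↭-sym G↭)))
      (permʳ (prep 𝟘 (↭-trans (↭-sym (∷↭∷ʳ a D')) (↭-sym D↭)))
        (weakenʳ (𝟘 ∷ D') (weakenˡ (𝟙 ∷ G') (axiom (≤-refl a)))))

  contractʳ* : ∀ {a G D} → a ∈ D → G ⊢* (D ∷ʳ a) → G ⊢* D
  contractʳ* {a} {G} {D} a∈D G⊢*D,a =
    cut* a (identity* (∈-++⁺ʳ G (here refl)) a∈D) (permʳ* (↭-sym (∷↭∷ʳ a D)) G⊢*D,a)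

  cut-all* : ∀ A {G D} → (G ++ A) ⊢* D → (∀ a → a ∈ A → G ⊢* (D ∷ʳ a)) → G ⊢* D
  cut-all* []      {G} {D} G⊢*D _ = subst (_⊢* D) (++-identityʳ G) G⊢*D
  cut-all* (a ∷ A) {G} {D} G,A⊢*D A-derivable =
    cut* a (cut-all* A (subst (_⊢* D) (sym (++-assoc G [ a ] A)) G,A⊢*D)
                       (λ a' a'∈A → weakenˡ* [ a ] (A-derivable a' (there a'∈A))))
           (permʳ* (↭-sym (∷↭∷ʳ a D)) (A-derivable a (here refl)))

-- J is a monad on monotone predicates (unit,
-- bind, pairing), which is what soundness of the lattice laws needs.
module Nucleus {W : Set} (_≼_ : W → W → Set)
  (≼-refl : ∀ p → p ≼ p) (≼-trans : ∀ {p q r} → p ≼ q → q ≼ r → p ≼ r)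
  (Z : W → Set) where

  Mono : (W → Set) → Set
  Mono U = ∀ {p q} → p ≼ q → U p → U q

  J : (W → Set) → W → Set
  J U p = ∀ q → p ≼ q → (∀ r → q ≼ r → U r → Z r) → Z q

  J-mono : ∀ {U} → Mono (J U)
  J-mono p≼q JUp r q≼r refutes = JUp r (≼-trans p≼q q≼r) refutes

  J-unit : ∀ {U} → Mono U → ∀ {p} → U p → J U p
  J-unit U-mono {p} Up q p≼q refutes = refutes q (≼-refl q) (U-mono p≼q Up)

  J-bind : ∀ {U V p} → J U p → (∀ r → p ≼ r → U r → J V r) → J V p
  J-bind JUp f q p≼q refutes =
    JUp q p≼q λ r q≼r Ur → f r (≼-trans p≼q q≼r) Ur r (≼-refl r)
      λ s r≼s Vs → refutes s (≼-trans q≼r r≼s) Vs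

  J-pair : ∀ {U V} → Mono U → ∀ {p} → J U p → J V p → J (λ x → U x × V x) p
  J-pair U-mono JUp JVp q p≼q refutes =
    JUp q p≼q λ r q≼r Ur → JVp r (≼-trans p≼q q≼r) λ s r≼s Vs →
      refutes s (≼-trans q≼r r≼s) (U-mono r≼s Ur , Vs)

module FreeLattice (M : BoundedPreorder)
  (_⊢_ : List⁺ (BoundedPreorder.Carrier M) → List⁺ (BoundedPreorder.Carrier M) → Set)
  where
  open BoundedPreorder M renaming (Carrier to C)

  infixr 6 _∧f_
  infixr 5 _∨f_
  data Form : Set where
    gen       : C → Form
    ⊥f ⊤f     : Form
    _∧f_ _∨f_ : Form → Form → Form
    ¬f        : Form → Form
    ⋀f ⋁f     : CSub Form → Form

  fold∧ fold∨ : List⁺ C → Form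
  fold∧ as = List⁺.foldr₁ _∧f_ (List⁺.map gen as)
  fold∨ bs = List⁺.foldr₁ _∨f_ (List⁺.map gen bs)

  infix 4 _≤f_
  data _≤f_ : Form → Form → Set where
    refl≤  : ∀ {a} → a ≤f a
    trans≤ : ∀ {a b c} → a ≤f b → b ≤f c → a ≤f c
    ⊥-least  : ∀ {a} → ⊥f ≤f a
    ⊤-great  : ∀ {a} → a ≤f ⊤f
    ∧-lower₁ : ∀ {a b} → a ∧f b ≤f a
    ∧-lower₂ : ∀ {a b} → a ∧f b ≤f b
    ∧-great  : ∀ {h a b} → h ≤f a → h ≤f b → h ≤f a ∧f b
    ∨-upper₁ : ∀ {a b} → a ≤f a ∨f b
    ∨-upper₂ : ∀ {a b} → b ≤f a ∨f b
    ∨-least  : ∀ {h a b} → a ≤f h → b ≤f h → a ∨f b ≤f h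
    distrib  : ∀ {a b c} → a ∧f c ≤f b → a ≤f b ∨f c → a ≤f b
    compl-∧  : ∀ {c} → c ∧f ¬f c ≤f ⊥f
    compl-∨  : ∀ {c} → ⊤f ≤f c ∨f ¬f c
    ⋀-lower  : ∀ {e y} → y ∈ₑ e → ⋀f e ≤f y
    ⋀-great  : ∀ {e h} → (∀ y → y ∈ₑ e → h ≤f y) → h ≤f ⋀f e
    ⋁-upper  : ∀ {e y} → y ∈ₑ e → y ≤f ⋁f e
    ⋁-least  : ∀ {e h} → (∀ y → y ∈ₑ e → y ≤f h) → ⋁f e ≤f h
    sequent  : ∀ {as bs} → as ⊢ bs → fold∧ as ≤f fold∨ bs

  FreeCCBL : CCBL
  FreeCCBL = record
    { Carrier = Form ; _≤_ = _≤f_ ; ≤-refl = λ _ → refl≤ ; ≤-trans = trans≤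
    ; 𝟘 = ⊥f ; 𝟙 = ⊤f ; 𝟘-least = λ _ → ⊥-least ; 𝟙-great = λ _ → ⊤-great
    ; _∧_ = _∧f_ ; _∨_ = _∨f_
    ; ∧-glb = λ a b → (λ { _ (inj₁ refl) → ∧-lower₁ ; _ (inj₂ refl) → ∧-lower₂ }) ,
                      (λ h h≤ → ∧-great (h≤ a (inj₁ refl)) (h≤ b (inj₂ refl)))
    ; ∨-lub = λ a b → (λ { _ (inj₁ refl) → ∨-upper₁ ; _ (inj₂ refl) → ∨-upper₂ }) ,
                      (λ h ≤h → ∨-least (≤h a (inj₁ refl)) (≤h b (inj₂ refl)))
    ; distrib = λ _ _ _ → distrib
    ; ¬_ = ¬f ; compl-∧ = λ _ → compl-∧ ; compl-∨ = λ _ → compl-∨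
    ; ⋀ = ⋀f ; ⋁ = ⋁f
    ; ⋀-glb = λ _ → (λ _ → ⋀-lower) , (λ _ → ⋀-great)
    ; ⋁-lub = λ _ → (λ _ → ⋁-upper) , (λ _ → ⋁-least)
    }

-- We interpret formulas in the worlds
-- (G , D) of sequents, ordered by weakening, with the closed worlds
-- G ⊢* D as "absurd" and atoms a forced at (G , D) when G ⊢* D , a.
-- The inequalities of the free lattice are sound for this semantics, and
-- a forced sequent is derivable (completeness at generators).
module Conservativity (M : BoundedPreorder)
  (_⊢_ : List⁺ (BoundedPreorder.Carrier M) → List⁺ (BoundedPreorder.Carrier M) → Set)
  (ax : SequentAxioms M _⊢_) where
  open BoundedPreorder M renaming (Carrier to C)
  open Sequents M _⊢_ ax
  open FreeLattice M _⊢_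

  World : Set
  World = List C × List C

  _≼_ : World → World → Set
  (G , D) ≼ (G' , D') = Σ (List C) λ E → Σ (List C) λ F → (G' ≡ G ++ E) × (D' ≡ F ++ D)

  ≼-refl : ∀ p → p ≼ p
  ≼-refl (G , D) = [] , [] , sym (++-identityʳ G) , refl

  ≼-trans : ∀ {p q r} → p ≼ q → q ≼ r → p ≼ r
  ≼-trans {G , D} (E , F , refl , refl) (E' , F' , refl , refl) =
    E ++ E' , F' ++ F , ++-assoc G E E' , sym (++-assoc F' F D)

  Closed : World → Set
  Closed (G , D) = G ⊢* D

  open Nucleus _≼_ ≼-refl ≼-trans Closed

  mutual
    ⟦_⟧ : Form → World → Set
    ⟦ gen a ⟧  (G , D) = G ⊢* (D ∷ʳ a)
    ⟦ ⊥f ⟧     _ = ⊥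
    ⟦ ⊤f ⟧     _ = ⊤
    ⟦ φ ∧f ψ ⟧ p = ⟦ φ ⟧ p × ⟦ ψ ⟧ p
    ⟦ φ ∨f ψ ⟧ p = ⟦ φ ⟧ p ⊎ ⟦ ψ ⟧ p
    ⟦ ¬f φ ⟧   p = ∀ q → p ≼ q → ⟦ φ ⟧ q → Closed q
    ⟦ ⋀f e ⟧   p = ∀ n → ⟦ e n ⟧ᴶ? p
    ⟦ ⋁f e ⟧   p = Σ ℕ λ n → ⟦ e n ⟧? p

    ⟦_⟧ᴶ? : Maybe Form → World → Set
    ⟦ nothing ⟧ᴶ? _ = ⊤
    ⟦ just y ⟧ᴶ?  p = J ⟦ y ⟧ p

    ⟦_⟧? : Maybe Form → World → Set
    ⟦ nothing ⟧? _ = ⊥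
    ⟦ just y ⟧?  p = ⟦ y ⟧ p

  mutual
    ⟦⟧-mono : ∀ φ → Mono ⟦ φ ⟧
    ⟦⟧-mono (gen a) {G , D} (E , F , refl , refl) G⊢*D,a =
      subst (G ++ E ⊢*_) (sym (++-assoc F D [ a ])) (weakenʳ* F (weakenˡ* E G⊢*D,a))
    ⟦⟧-mono ⊥f       _ ()
    ⟦⟧-mono ⊤f       _ _ = tt
    ⟦⟧-mono (φ ∧f ψ) p≼q (x , y) = ⟦⟧-mono φ p≼q x , ⟦⟧-mono ψ p≼q y
    ⟦⟧-mono (φ ∨f ψ) p≼q (inj₁ x) = inj₁ (⟦⟧-mono φ p≼q x)
    ⟦⟧-mono (φ ∨f ψ) p≼q (inj₂ y) = inj₂ (⟦⟧-mono ψ p≼q y)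
    ⟦⟧-mono (¬f φ)   p≼q refutes r q≼r = refutes r (≼-trans p≼q q≼r)
    ⟦⟧-mono (⋀f e)   p≼q all n = ⟦⟧ᴶ?-mono (e n) p≼q (all n)
    ⟦⟧-mono (⋁f e)   p≼q (n , some) = n , ⟦⟧?-mono (e n) p≼q some

    ⟦⟧ᴶ?-mono : ∀ m → Mono ⟦ m ⟧ᴶ?
    ⟦⟧ᴶ?-mono nothing  _ _ = tt
    ⟦⟧ᴶ?-mono (just y) p≼q = J-mono p≼q

    ⟦⟧?-mono : ∀ m → Mono ⟦ m ⟧?
    ⟦⟧?-mono nothing  _ ()
    ⟦⟧?-mono (just y) p≼q = ⟦⟧-mono y p≼q

  return : ∀ φ {p} → ⟦ φ ⟧ p → J ⟦ φ ⟧ p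
  return φ = J-unit (⟦⟧-mono φ)

  infix 4 _⊑_
  _⊑_ : Form → Form → Set
  φ ⊑ ψ = ∀ p → ⟦ φ ⟧ p → J ⟦ ψ ⟧ p

  fold∧-intro : ∀ x xs {p} → (∀ a → a ∈ x ∷ xs → ⟦ gen a ⟧ p) → ⟦ fold∧ (x ∷₁ xs) ⟧ p
  fold∧-intro x []       all = all x (here refl)
  fold∧-intro x (y ∷ ys) all = all x (here refl) , fold∧-intro y ys λ a a∈ → all a (there a∈)

  fold∧-elim : ∀ x xs {p} → ⟦ fold∧ (x ∷₁ xs) ⟧ p → ∀ a → a ∈ x ∷ xs → ⟦ gen a ⟧ p
  fold∧-elim x []       forced       _ (here refl) = forced
  fold∧-elim x (y ∷ ys) (forced , _) _ (here refl) = forced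
  fold∧-elim x (y ∷ ys) (_ , forced) a (there a∈) = fold∧-elim y ys forced a a∈

  fold∨-intro : ∀ x xs {p} b → b ∈ x ∷ xs → ⟦ gen b ⟧ p → ⟦ fold∨ (x ∷₁ xs) ⟧ p
  fold∨-intro x []       _ (here refl) forced = forced
  fold∨-intro x (y ∷ ys) _ (here refl) forced = inj₁ forced
  fold∨-intro x (y ∷ ys) b (there b∈) forced = inj₂ (fold∨-intro y ys b b∈ forced)

  fold∨-elim : ∀ x xs {p} → ⟦ fold∨ (x ∷₁ xs) ⟧ p → Σ C λ b → b ∈ x ∷ xs × ⟦ gen b ⟧ p
  fold∨-elim x []       forced        = x , here refl , forced
  fold∨-elim x (y ∷ ys) (inj₁ forced) = x , here refl , forced
  fold∨-elim x (y ∷ ys) (inj₂ forced) =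
    let (b , b∈ , forced-b) = fold∨-elim y ys forced in b , there b∈ , forced-b

  discharge : ∀ {q} y ys → (∀ r → q ≼ r → ⟦ fold∨ (y ∷₁ ys) ⟧ r → Closed r) →
              ∀ L → (∀ b → b ∈ L → b ∈ y ∷ ys) →
              ∀ {G D} → q ≼ (G , D) → G ⊢* (L ++ D) → Closed (G , D)
  discharge y ys refute []      _    _ G⊢*D = G⊢*D
  discharge y ys refute (b ∷ L) L⊆B {G} {D} q≼r G⊢*b,L,D =
    refute (G , D) q≼r (fold∨-intro y ys b (L⊆B b (here refl)) (permʳ* (∷↭∷ʳ b D) G⊢*b,D))
    where
    G⊢*b,D : G ⊢* (b ∷ D)
    G⊢*b,D = discharge y ys refute L (λ b' b'∈L → L⊆B b' (there b'∈L))
      (≼-trans q≼r ([] , [ b ] , sym (++-identityʳ G) , refl))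
      (permʳ* (↭-sym (shift b L D)) G⊢*b,L,D)

  -- the axioms a₁ ∧ … ∧ aₘ ≤ b₁ ∨ … ∨ bₙ are sound: at an extension q of a
  -- world forcing all aᵢ, cut them from the (weakened) sequent and discharge
  -- the conclusions bⱼ one at a time
  sound-sequent : ∀ {as bs} → as ⊢ bs → fold∧ as ⊑ fold∨ bs
  sound-sequent {x ∷₁ xs} {y ∷₁ ys} as⊢bs (G , D) forced _ q@(E , F , refl , refl) refute =
    discharge y ys refute B (λ _ b∈B → b∈B) (≼-refl _) Gq⊢*B,Dq
    where
    A B Gq Dq : List C
    A = x ∷ xs
    B = y ∷ ys
    Gq = G ++ E
    Dq = F ++ D

    Gq,A⊢*B,Dq : (Gq ++ A) ⊢* (B ++ Dq)
    Gq,A⊢*B,Dq = permˡ* (++-comm A Gq) (permʳ* (++-comm Dq B)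
      (weakenʳ* Dq (weakenˡ* Gq (raise as⊢bs))))

    Gq⊢*B,Dq,a : ∀ a → a ∈ A → Gq ⊢* ((B ++ Dq) ∷ʳ a)
    Gq⊢*B,Dq,a a a∈A = subst (Gq ⊢*_) (sym (++-assoc B Dq [ a ]))
      (weakenʳ* B (⟦⟧-mono (gen a) q (fold∧-elim x xs forced a a∈A)))

    Gq⊢*B,Dq : Gq ⊢* (B ++ Dq)
    Gq⊢*B,Dq = cut-all* A Gq,A⊢*B,Dq Gq⊢*B,Dq,a

  -- completeness at generators: the world (as , bs) forces every aᵢ, and
  -- any extension of it forcing some bⱼ is closed by contraction
  complete : ∀ {as bs} → fold∧ as ⊑ fold∨ bs → as ⊢ bs
  complete {x ∷₁ xs} {y ∷₁ ys} as⊑bs =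
    lower (as⊑bs p₀ (fold∧-intro x xs λ a a∈A → identity* a∈A (∈-++⁺ʳ (y ∷ ys) (here refl)))
                 p₀ (≼-refl p₀) refute)
    where
    p₀ : World
    p₀ = x ∷ xs , y ∷ ys

    refute : ∀ r → p₀ ≼ r → ⟦ fold∨ (y ∷₁ ys) ⟧ r → Closed r
    refute _ (E , F , refl , refl) forced =
      let (b , b∈B , G⊢*D,b) = fold∨-elim y ys forced
      in contractʳ* (∈-++⁺ʳ F b∈B) G⊢*D,b

  sound : ∀ {φ ψ} → φ ≤f ψ → φ ⊑ ψ
  sound (refl≤ {φ}) p x = return φ x
  sound (trans≤ φ≤χ χ≤ψ) p x = J-bind (sound φ≤χ p x) λ r _ y → sound χ≤ψ r y
  sound ⊥-least p ()
  sound ⊤-great p _ = return ⊤f tt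
  sound (∧-lower₁ {φ}) p (x , _) = return φ x
  sound (∧-lower₂ {b = ψ}) p (_ , y) = return ψ y
  sound (∧-great {a = φ} h≤φ h≤ψ) p x = J-pair (⟦⟧-mono φ) (sound h≤φ p x) (sound h≤ψ p x)
  sound (∨-upper₁ {φ} {ψ}) p x = return (φ ∨f ψ) (inj₁ x)
  sound (∨-upper₂ {φ} {ψ}) p y = return (φ ∨f ψ) (inj₂ y)
  sound (∨-least φ≤h ψ≤h) p (inj₁ x) = sound φ≤h p x
  sound (∨-least φ≤h ψ≤h) p (inj₂ y) = sound ψ≤h p y
  sound (distrib {a} {b} a∧c≤b a≤b∨c) p x =
    J-bind (sound a≤b∨c p x) λ
      { r _   (inj₁ y) → return b y
      ; r p≼r (inj₂ z) → sound a∧c≤b r (⟦⟧-mono a p≼r x , z) }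
  sound (compl-∧ {c}) p (x , refutes) q p≼q _ = refutes q p≼q (⟦⟧-mono c p≼q x)
  sound compl-∨ p _ q _ refute = refute q (≼-refl q) (inj₂ λ r q≼r x → refute r q≼r (inj₁ x))
  sound (⋀-lower {e} (n , eₙ≡y)) p all = subst (λ m → ⟦ m ⟧ᴶ? p) eₙ≡y (all n)
  sound (⋀-great {e} {h} h≤e) p x = return (⋀f e) λ n → entry n (e n) refl
    where
    entry : ∀ n m → e n ≡ m → ⟦ m ⟧ᴶ? p
    entry n nothing  _    = tt
    entry n (just y) eₙ≡y = sound (h≤e y (n , eₙ≡y)) p x
  sound (⋁-upper {e} (n , eₙ≡y)) p y = return (⋁f e) (n , subst (λ m → ⟦ m ⟧? p) (sym eₙ≡y) y)
  sound (⋁-least {e} {h} e≤h) p (n , some) = entry (e n) refl some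
    where
    entry : ∀ m → e n ≡ m → ⟦ m ⟧? p → J ⟦ h ⟧ p
    entry nothing  _    ()
    entry (just y) eₙ≡y y-forced = sound (e≤h y (n , eₙ≡y)) p y-forced
  sound (sequent as⊢bs) = sound-sequent as⊢bs

  reflect : ∀ {as bs} → fold∧ as ≤f fold∨ bs → as ⊢ bs
  reflect as≤bs = complete (sound as≤bs)

module Evaluation (M : BoundedPreorder)
  (_⊢_ : List⁺ (BoundedPreorder.Carrier M) → List⁺ (BoundedPreorder.Carrier M) → Set)
  (V' : CCBLOver M) (represents' : Represents M V' _⊢_) where
  open FreeLattice M _⊢_
  private
    module W = CCBLOver V'
    module F' = LatticeFacts W.lat

  mutual
    eval : Form → W.Carrier
    eval (gen a)  = W.ι a
    eval ⊥f       = W.𝟘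
    eval ⊤f       = W.𝟙
    eval (φ ∧f ψ) = eval φ W.∧ eval ψ
    eval (φ ∨f ψ) = eval φ W.∨ eval ψ
    eval (¬f φ)   = W.¬ (eval φ)
    eval (⋀f e)   = W.⋀ (λ n → eval? (e n))
    eval (⋁f e)   = W.⋁ (λ n → eval? (e n))

    eval? : Maybe Form → Maybe W.Carrier
    eval? nothing  = nothing
    eval? (just φ) = just (eval φ)

  eval?-just : ∀ m x → eval? m ≡ just x → Σ Form λ φ → m ≡ just φ × eval φ ≡ x
  eval?-just (just φ) _ refl = φ , refl , refl

  eval-enum : ∀ e → F'._⋈_ (λ x → x ∈ₑ (λ n → eval? (e n))) (Image eval e)
  eval-enum e = (λ x x∈ → x , member x x∈ , F'.≋-refl) ,
                (λ { _ (φ , (n , eₙ≡φ) , refl) → eval φ , (n , cong eval? eₙ≡φ) , F'.≋-refl })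
    where
    member : ∀ x → x ∈ₑ (λ n → eval? (e n)) → Image eval e x
    member x (n , eq) with eval?-just (e n) x eq
    ... | φ , eₙ≡φ , refl = φ , (n , eₙ≡φ) , refl

  eval-⋀ : ∀ e → IsGLB W._≤_ (Image eval e) (eval (⋀f e))
  eval-⋀ e = F'.glb-resp (eval-enum e) (W.⋀-glb _)

  eval-⋁ : ∀ e → IsLUB W._≤_ (Image eval e) (eval (⋁f e))
  eval-⋁ e = F'.lub-resp (eval-enum e) (W.⋁-lub _)

  eval-fold∧ : ∀ x xs → eval (fold∧ (x ∷₁ xs)) ≡ List⁺.foldr₁ W._∧_ (List⁺.map W.ι (x ∷₁ xs))
  eval-fold∧ x []       = refl
  eval-fold∧ x (y ∷ ys) = cong (W.ι x W.∧_) (eval-fold∧ y ys)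

  eval-fold∨ : ∀ x xs → eval (fold∨ (x ∷₁ xs)) ≡ List⁺.foldr₁ W._∨_ (List⁺.map W.ι (x ∷₁ xs))
  eval-fold∨ x []       = refl
  eval-fold∨ x (y ∷ ys) = cong (W.ι x W.∨_) (eval-fold∨ y ys)

  eval-mono : ∀ {φ ψ} → φ ≤f ψ → eval φ W.≤ eval ψ
  eval-mono (refl≤ {φ})      = W.≤-refl (eval φ)
  eval-mono (trans≤ p q)     = W.≤-trans (eval-mono p) (eval-mono q)
  eval-mono ⊥-least          = W.𝟘-least _
  eval-mono ⊤-great          = W.𝟙-great _
  eval-mono ∧-lower₁         = F'.∧-lower₁ _ _
  eval-mono ∧-lower₂         = F'.∧-lower₂ _ _
  eval-mono (∧-great p q)    = F'.∧-greatest (eval-mono p) (eval-mono q)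
  eval-mono ∨-upper₁         = F'.∨-upper₁ _ _
  eval-mono ∨-upper₂         = F'.∨-upper₂ _ _
  eval-mono (∨-least p q)    = F'.∨-least (eval-mono p) (eval-mono q)
  eval-mono (distrib p q)    = W.distrib _ _ _ (eval-mono p) (eval-mono q)
  eval-mono compl-∧          = W.compl-∧ _
  eval-mono compl-∨          = W.compl-∨ _
  eval-mono (⋀-lower {e} {y} y∈e) = proj₁ (eval-⋀ e) (eval y) (y , y∈e , refl)
  eval-mono (⋀-great {e} {h} h≤e) =
    proj₂ (eval-⋀ e) (eval h) λ { _ (φ , φ∈e , refl) → eval-mono (h≤e φ φ∈e) }
  eval-mono (⋁-upper {e} {y} y∈e) = proj₁ (eval-⋁ e) (eval y) (y , y∈e , refl)
  eval-mono (⋁-least {e} {h} e≤h) =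
    proj₂ (eval-⋁ e) (eval h) λ { _ (φ , φ∈e , refl) → eval-mono (e≤h φ φ∈e) }
  eval-mono (sequent {x ∷₁ xs} {y ∷₁ ys} as⊢bs) =
    subst₂ W._≤_ (sym (eval-fold∧ x xs)) (sym (eval-fold∨ y ys)) (Equivalence.to (represents' _ _) as⊢bs)

  evaluation : Preserving (FreeLattice.FreeCCBL M _⊢_) W.lat
  evaluation = record
    { map    = eval
    ; mono   = eval-mono
    ; pres-∧ = λ _ _ → F'.≋-refl
    ; pres-∨ = λ _ _ → F'.≋-refl
    ; pres-¬ = λ _ → F'.≋-refl
    ; pres-⋀ = eval-⋀
    ; pres-⋁ = eval-⋁
    }

module FreeOver (M : BoundedPreorder)
  (_⊢_ : List⁺ (BoundedPreorder.Carrier M) → List⁺ (BoundedPreorder.Carrier M) → Set)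
  (ax : SequentAxioms M _⊢_) where
  open FreeLattice M _⊢_
  open Conservativity M _⊢_ ax using (reflect)

  gen-injective : ∀ a b → gen a ≡ gen b → a ≡ b
  gen-injective a .a refl = refl

  V : CCBLOver M
  V = record
    { lat = FreeCCBL ; ι = gen ; ι-inj = gen-injective
    ; ι-order = λ a b → mk⇔ (λ a≤b → sequent (Equivalence.from (SequentAxioms.ax1 ax a b) a≤b))
                           (λ a≤b → Equivalence.to (SequentAxioms.ax1 ax a b) (reflect a≤b))
    }

  represents : Represents M V _⊢_
  represents as bs = mk⇔ sequent reflect

  initial : ∀ V' → CCBLOver.Minimal V' → Represents M V' _⊢_ →
            Σ (Hom (CCBLOver.lat V) (CCBLOver.lat V')) λ h →
              Hom.Onto h × (∀ a → Hom._∼_ h (CCBLOver.ι V a) (CCBLOver.ι V' a))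
  initial V' minimal represents' =
    GraphHom.hom evaluation , GraphOnto.onto V V' minimal evaluation fixes-M , fixes-M
    where
    open Evaluation M _⊢_ V' represents' using (evaluation)

    fixes-M : ∀ a → CCBLOver._≋_ V' (CCBLOver.ι V' a) (CCBLOver.ι V' a)
    fixes-M a = LatticeFacts.≋-refl (CCBLOver.lat V')

theorem10 : (M : BoundedPreorder) →
    (_⊢_ : List⁺ (BoundedPreorder.Carrier M) → List⁺ (BoundedPreorder.Carrier M) → Set) →
    SequentAxioms M _⊢_ →
    Σ (CCBLOver M) λ V →
      Represents M V _⊢_ ×
      (∀ (V' : CCBLOver M) → CCBLOver.Minimal V' → Represents M V' _⊢_ →
        Σ (Hom (CCBLOver.lat V) (CCBLOver.lat V')) λ h →
          Hom.Onto h ×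
          (∀ a → Hom._∼_ h (CCBLOver.ι V a) (CCBLOver.ι V' a)))
theorem10 M _⊢_ ax = V , represents , initial
  where open FreeOver M _⊢_ ax using (V; represents; initial)
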